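{- Let $G$ be a finite, simple, undirected, connected graph with at least two vertices. If $\gamma_t(G) = i_0(G) + 1$, then $G$ has a dominating vertex, i.e. a vertex adjacent to every other vertex of $G$.
   Context: A set $S \subseteq V(G)$ is a total dominating set of $G$ if every vertex of $G$ (including those in $S$) has a neighbor in $S$; $\gamma_t(G)$ is the minimum cardinality of a total dominating set. A set $S \subseteq V(G)$ is an isolate set if the induced subgraph $G[S]$ has at least one isolated vertex (a vertex of degree $0$ in $G[S]$). An isolate set is maximal if no proper superset of it is an isolate set. The isolate number $i_0(G)$ is the minimum cardinality of a maximal isolate set of $G$. -}

module Defs where

open import Data.Nat using (ℕ; suc; _≤_; _≥_)
open import Data.Fin using (Fin)
open import Data.Fin.Subset using (Subset; _∈_; _∉_; _⊆_; _⊂_; ∣_∣)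
open import Data.Product using (Σ; ∃; _×_; _,_)
open import Relation.Nullary using (¬_; Dec)
open import Relation.Binary.PropositionalEquality using (_≡_; _≢_)

record Graph (n : ℕ) : Set₁ where
  field
    Adj     : Fin n → Fin n → Set
    adj?    : ∀ u v → Dec (Adj u v)
    sym     : ∀ {u v} → Adj u v → Adj v u
    irrefl  : ∀ {u} → ¬ Adj u u

module _ {n : ℕ} (G : Graph n) where
  open Graph G

  data Walk : Fin n → Fin n → Set where
    here : ∀ {u} → Walk u u
    step : ∀ {u v w} → Adj u v → Walk v w → Walk u w

  Connected : Set
  Connected = ∀ u v → Walk u v

  Dominating : Fin n → Set
  Dominating v = ∀ u → u ≢ v → Adj v u

  IsTotalDominatingSet : Subset n → Set
  IsTotalDominatingSet S = ∀ v → ∃ λ u → u ∈ S × Adj v u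

  IsMinTotalDominatingSet : Subset n → Set
  IsMinTotalDominatingSet S =
    IsTotalDominatingSet S × (∀ T → IsTotalDominatingSet T → ∣ S ∣ ≤ ∣ T ∣)

  IsIsolateSet : Subset n → Set
  IsIsolateSet S = ∃ λ v → v ∈ S × (∀ u → u ∈ S → ¬ Adj v u)

  IsMaximalIsolateSet : Subset n → Set
  IsMaximalIsolateSet S = IsIsolateSet S × (∀ T → S ⊂ T → ¬ IsIsolateSet T)

  IsMinMaximalIsolateSet : Subset n → Set
  IsMinMaximalIsolateSet S =
    IsMaximalIsolateSet S × (∀ T → IsMaximalIsolateSet T → ∣ S ∣ ≤ ∣ T ∣)

-- Let I be a minimum maximal isolate set and v a vertex isolated in G[I]. By maximality
-- v is adjacent to every vertex outside I, so if I = {v} then v dominates G. Otherwise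
-- connectivity gives an edge b u with b ∈ I - v and u ∉ I, and for a suitable x ∈ I - v
-- the set (I - x) ∪ {u} is a total dominating set (v dominates the outside of I). It has
-- at most |I| vertices, contradicting γ_t(G) = i_0(G) + 1.
module Submission where

open import Defs
open import Data.Nat using (ℕ; suc; _≥_; _≤_; _+_; z≤n; s≤s)
open import Data.Nat.Properties using (≤-trans; +-suc; +-comm; m≤n⇒m≤1+n; 1+n≰n; module ≤-Reasoning)
open import Data.Fin using (Fin; _≟_)
open import Data.Fin.Properties using (any?)
open import Data.Fin.Subset using (Subset; ∣_∣; _∈_; _∉_; _⊂_; _∪_; _-_; ⁅_⁆; inside; outside)
open import Data.Fin.Subset.Properties
  using (_∈?_; x∈⁅x⁆; x∈⁅y⁆⇒x≡y; ∣⁅x⁆∣≡1; p⊆p∪q; x∈p∪q⁺; x∈p∪q⁻; x∈p∧x≢y⇒x∈p-y; x∈p⇒∣p-x∣<∣p∣)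
open import Data.Vec using (_∷_; [])
open import Data.Product using (∃; ∃₂; _×_; _,_)
open import Data.Sum using (inj₁; inj₂)
open import Data.Empty using (⊥-elim)
open import Relation.Nullary using (¬_; Dec; yes; no)
open import Relation.Unary using (Decidable)
open import Relation.Nullary.Decidable using (_×-dec_; ¬?)
open import Relation.Binary.PropositionalEquality using (_≡_; _≢_; refl; sym; cong; subst)

∣p∪q∣≤∣p∣+∣q∣ : ∀ {n} (p q : Subset n) → ∣ p ∪ q ∣ ≤ ∣ p ∣ + ∣ q ∣
∣p∪q∣≤∣p∣+∣q∣ []            []            = z≤n
∣p∪q∣≤∣p∣+∣q∣ (inside  ∷ p) (inside  ∷ q)
  rewrite +-suc ∣ p ∣ ∣ q ∣ = s≤s (m≤n⇒m≤1+n (∣p∪q∣≤∣p∣+∣q∣ p q))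
∣p∪q∣≤∣p∣+∣q∣ (inside  ∷ p) (outside ∷ q) = s≤s (∣p∪q∣≤∣p∣+∣q∣ p q)
∣p∪q∣≤∣p∣+∣q∣ (outside ∷ p) (inside  ∷ q)
  rewrite +-suc ∣ p ∣ ∣ q ∣ = s≤s (∣p∪q∣≤∣p∣+∣q∣ p q)
∣p∪q∣≤∣p∣+∣q∣ (outside ∷ p) (outside ∷ q) = ∣p∪q∣≤∣p∣+∣q∣ p q

∣p-x∪⁅y⁆∣≤∣p∣ : ∀ {n} {p : Subset n} {x} y → x ∈ p → ∣ (p - x) ∪ ⁅ y ⁆ ∣ ≤ ∣ p ∣
∣p-x∪⁅y⁆∣≤∣p∣ {p = p} {x} y x∈p = begin
  ∣ (p - x) ∪ ⁅ y ⁆ ∣    ≤⟨ ∣p∪q∣≤∣p∣+∣q∣ (p - x) ⁅ y ⁆ ⟩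
  ∣ p - x ∣ + ∣ ⁅ y ⁆ ∣  ≡⟨ cong (∣ p - x ∣ +_) (∣⁅x⁆∣≡1 y) ⟩
  ∣ p - x ∣ + 1          ≡⟨ +-comm ∣ p - x ∣ 1 ⟩
  suc ∣ p - x ∣          ≤⟨ x∈p⇒∣p-x∣<∣p∣ x∈p ⟩
  ∣ p ∣                  ∎
  where open ≤-Reasoning

module _ {n : ℕ} (G : Graph n) where
  open Graph G renaming (sym to adj-sym)

  HasNeighbourIn : Subset n → Fin n → Set
  HasNeighbourIn S y = ∃ λ z → z ∈ S × Adj y z

  hasNeighbourIn? : ∀ S y → Dec (HasNeighbourIn S y)
  hasNeighbourIn? S y = any? (λ z → (z ∈? S) ×-dec adj? y z)

  IsolatedIn : Subset n → Fin n → Set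
  IsolatedIn S y = ∀ z → z ∈ S → ¬ Adj y z

  walk-leaves : ∀ {p} {P : Fin n → Set p} → Decidable P → ∀ {y t} → Walk G y t → P y → ¬ P t →
                ∃₂ λ a c → P a × ¬ P c × Adj a c
  walk-leaves P? here              Py ¬Pt = ⊥-elim (¬Pt Py)
  walk-leaves P? (step {v = z} yz w) Py ¬Pt with P? z
  ... | yes Pz = walk-leaves P? w Pz ¬Pt
  ... | no ¬Pz = _ , z , Py , ¬Pz , yz

  -- A walk from b to v must leave I, and it cannot do so at v.
  connected⇒edge-leaving : Connected G → ∀ {I v b} → IsolatedIn I v → b ∈ I → b ≢ v →
                           ∃₂ λ a c → a ∈ I × a ≢ v × c ∉ I × Adj a c
  connected⇒edge-leaving connected {I} {v} {b} v-iso b∈I b≢v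
    with walk-leaves (λ z → (z ∈? I) ×-dec ¬? (z ≟ v)) (connected b v)
                     (b∈I , b≢v) (λ (_ , v≢v) → v≢v refl)
  ... | a , c , (a∈I , a≢v) , ¬c∈I-v , ac = a , c , a∈I , a≢v , c∉I , ac
    where
    c∉I : c ∉ I
    c∉I c∈I with c ≟ v
    ... | yes refl = v-iso a a∈I (adj-sym ac)
    ... | no c≢v = ¬c∈I-v (c∈I , c≢v)

  module MaximalIsolateSet {I : Subset n} (maximal : ∀ T → I ⊂ T → ¬ IsIsolateSet G T) where

    -- Adding a non-neighbour w of a to I would keep a isolated.
    isolated⇒adjacent-outside : ∀ {a w} → a ∈ I → IsolatedIn I a → w ∉ I → Adj a w
    isolated⇒adjacent-outside {a} {w} a∈I a-iso w∉I with adj? a w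
    ... | yes aw = aw
    ... | no ¬aw = ⊥-elim (maximal (I ∪ ⁅ w ⁆) I⊂I∪⁅w⁆ (a , x∈p∪q⁺ (inj₁ a∈I) , a-iso′))
      where
      I⊂I∪⁅w⁆ : I ⊂ I ∪ ⁅ w ⁆
      I⊂I∪⁅w⁆ = p⊆p∪q ⁅ w ⁆ , w , x∈p∪q⁺ (inj₂ (x∈⁅x⁆ w)) , w∉I

      a-iso′ : IsolatedIn (I ∪ ⁅ w ⁆) a
      a-iso′ z z∈I∪⁅w⁆ with x∈p∪q⁻ I ⁅ w ⁆ z∈I∪⁅w⁆
      ... | inj₁ z∈I  = a-iso z z∈I
      ... | inj₂ z∈⁅w⁆ rewrite x∈⁅y⁆⇒x≡y w z∈⁅w⁆ = ¬aw

    nonadjacent-outside⇒hasNeighbourIn : ∀ {a w} → a ∈ I → w ∉ I → ¬ Adj a w → HasNeighbourIn I a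
    nonadjacent-outside⇒hasNeighbourIn {a} a∈I w∉I ¬aw with hasNeighbourIn? I a
    ... | yes has = has
    ... | no ¬has =
      ⊥-elim (¬aw (isolated⇒adjacent-outside a∈I (λ z z∈I az → ¬has (z , z∈I , az)) w∉I))

    module Exchange {v u : Fin n} (v∈I : v ∈ I) (v-iso : IsolatedIn I v) (u∉I : u ∉ I) where

      swap : Fin n → Subset n
      swap x = (I - x) ∪ ⁅ u ⁆

      ∈swap : ∀ {x z} → z ∈ I → z ≢ x → z ∈ swap x
      ∈swap z∈I z≢x = x∈p∪q⁺ (inj₁ (x∈p∧x≢y⇒x∈p-y z∈I z≢x))

      u∈swap : ∀ x → u ∈ swap x
      u∈swap x = x∈p∪q⁺ (inj₂ (x∈⁅x⁆ u))

      swap-totalDominating : ∀ {x} → x ≢ v → (∀ {y} → y ∈ I → HasNeighbourIn (swap x) y) →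
                             IsTotalDominatingSet G (swap x)
      swap-totalDominating x≢v dominatesI y with y ∈? I
      ... | yes y∈I = dominatesI y∈I
      ... | no  y∉I = v , ∈swap v∈I (λ v≡x → x≢v (sym v≡x)) ,
                      adj-sym (isolated⇒adjacent-outside v∈I v-iso y∉I)

      -- Try x = b first; if some y ∈ I has no neighbour in swap b, then x = y works,
      -- because a neighbour of y inside I - b would be a neighbour in swap b.
      exchangeable : ∀ {b} → b ∈ I → b ≢ v → Adj b u →
                     ∃ λ x → x ∈ I × x ≢ v × (∀ {y} → y ∈ I → HasNeighbourIn (swap x) y)
      exchangeable {b} b∈I b≢v bu with any? (λ y → (y ∈? I) ×-dec ¬? (hasNeighbourIn? (swap b) y))
      ... | no no-failure = b , b∈I , b≢v , dominatesI
        where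
        dominatesI : ∀ {y} → y ∈ I → HasNeighbourIn (swap b) y
        dominatesI {y} y∈I with hasNeighbourIn? (swap b) y
        ... | yes has = has
        ... | no ¬has = ⊥-elim (no-failure (y , y∈I , ¬has))
      ... | yes (x , x∈I , x-undominated) = x , x∈I , x≢v , dominatesI
        where
        x≢v : x ≢ v
        x≢v refl = x-undominated (u , u∈swap b , isolated⇒adjacent-outside v∈I v-iso u∉I)

        dominatesI : ∀ {y} → y ∈ I → HasNeighbourIn (swap x) y
        dominatesI {y} y∈I with adj? y u
        ... | yes yu = u , u∈swap x , yu
        ... | no ¬yu with nonadjacent-outside⇒hasNeighbourIn y∈I u∉I ¬yu
        ... | z , z∈I , yz = z , ∈swap z∈I z≢x , yz
          where
          y≢b : y ≢ b
          y≢b refl = ¬yu bu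

          z≢x : z ≢ x
          z≢x refl = x-undominated (y , ∈swap y∈I y≢b , adj-sym yz)

    nontrivial⇒smallTotalDominatingSet : Connected G → ∀ {v b} →
                                         v ∈ I → IsolatedIn I v → b ∈ I → b ≢ v →
                                         ∃ λ T → IsTotalDominatingSet G T × ∣ T ∣ ≤ ∣ I ∣
    nontrivial⇒smallTotalDominatingSet connected v∈I v-iso b∈I b≢v
      with connected⇒edge-leaving connected v-iso b∈I b≢v
    ... | b′ , u , b′∈I , b′≢v , u∉I , b′u
      with Exchange.exchangeable v∈I v-iso u∉I b′∈I b′≢v b′u
    ... | x , x∈I , x≢v , dominatesI =
      swap x , swap-totalDominating x≢v dominatesI , ∣p-x∪⁅y⁆∣≤∣p∣ u x∈I
      where open Exchange v∈I v-iso u∉I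

theorem2p4 : (n : ℕ) → n ≥ 2 → (G : Graph n) → Connected G →
    (D I : Subset n) → IsMinTotalDominatingSet G D → IsMinMaximalIsolateSet G I →
    ∣ D ∣ ≡ suc ∣ I ∣ →
    ∃ λ v → Dominating G v
theorem2p4 n _ G connected D I (_ , D-minimum) (((v , v∈I , v-iso) , maximal) , _) ∣D∣≡1+∣I∣
  with any? (λ b → (b ∈? I) ×-dec ¬? (b ≟ v))
... | no I⊆⁅v⁆ = v , λ w w≢v →
        isolated⇒adjacent-outside v∈I v-iso (λ w∈I → I⊆⁅v⁆ (w , w∈I , w≢v))
  where open MaximalIsolateSet G maximal
... | yes (b , b∈I , b≢v) with nontrivial⇒smallTotalDominatingSet connected v∈I v-iso b∈I b≢v
  where open MaximalIsolateSet G maximal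
...   | T , T-tds , ∣T∣≤∣I∣ =
  ⊥-elim (1+n≰n (subst (_≤ ∣ I ∣) ∣D∣≡1+∣I∣ (≤-trans (D-minimum T T-tds) ∣T∣≤∣I∣)))
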